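{- Let $N$ be an arboreal network and let $u,v$ be distinct vertices of $N$. (i) If $u$ is an ancestor of $v$, then exactly one child of $u$ is an ancestor of $v$, and every other child $u'$ of $u$ satisfies $C(u')\cap C(v)=\emptyset$. (ii) If $C(v)\subseteq C(u)$ and $u$ and $v$ are incomparable in $N$, then there exists a non-leaf vertex $h$ that is a descendant of both $u$ and $v$ and satisfies $C(h)=C(v)$.
   Context: In a digraph, a leaf is a vertex of indegree 1 and outdegree 0, a root is a vertex of indegree 0. A network on a finite set $X$ ($|X|\ge2$) is a simple acyclic digraph $N$ whose underlying undirected graph is connected, whose set of leaves is $X$, in which every vertex of indegree 0 has outdegree at least 2, every vertex of outdegree 0 has indegree 1, and no vertex has both indegree and outdegree equal to 1. $N$ is arboreal if its underlying undirected graph is a tree. $v$ is an ancestor of $w$ ($w$ a descendant of $v$) if there is a directed path (possibly of length 0) from $v$ to $w$; $u,v$ are incomparable if neither is an ancestor of the other. $C(v)$ is the set of leaves having $v$ as an ancestor. -}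

module Defs where

open import Data.Nat using (ℕ; zero; suc; _+_; _≤_)
open import Data.Bool using (Bool; true; false; T)
open import Data.Fin using (Fin; zero; suc)
open import Data.List using (List; []; _∷_; length)
open import Data.List.Relation.Unary.Unique.Propositional using (Unique)
open import Data.Product using (_×_; Σ; ∃)
open import Data.Sum using (_⊎_)
open import Data.Empty using (⊥)
open import Relation.Nullary using (¬_)
open import Relation.Binary.PropositionalEquality using (_≡_; _≢_)
open import Relation.Binary.Construct.Closure.ReflexiveTransitive using (Star)

count : ∀ {n} → (Fin n → Bool) → ℕ
count {zero} p = 0
count {suc n} p with p zero
... | true  = suc (count (λ i → p (suc i)))
... | false = count (λ i → p (suc i))

-- A finite digraph on vertex set Fin n, given by its arc relation (as a Bool
-- matrix).  A relation automatically has no multiple arcs.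
Digraph : ℕ → Set
Digraph n = Fin n → Fin n → Bool

module _ {n : ℕ} (G : Digraph n) where

  Arc : Fin n → Fin n → Set
  Arc u v = T (G u v)

  indeg : Fin n → ℕ
  indeg v = count (λ u → G u v)

  outdeg : Fin n → ℕ
  outdeg u = count (λ v → G u v)

  Ancestor : Fin n → Fin n → Set
  Ancestor = Star Arc

  Incomparable : Fin n → Fin n → Set
  Incomparable u v = ¬ Ancestor u v × ¬ Ancestor v u

  IsLeaf : Fin n → Set
  IsLeaf v = indeg v ≡ 1 × outdeg v ≡ 0

  IsRoot : Fin n → Set
  IsRoot v = indeg v ≡ 0

  leafCount : ℕ
  leafCount = count (λ v → isLeafB v)
    where
    isOne : ℕ → Bool
    isOne 1 = true
    isOne _ = false
    isZero : ℕ → Bool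
    isZero 0 = true
    isZero _ = false
    isLeafB : Fin n → Bool
    isLeafB v with isOne (indeg v) | isZero (outdeg v)
    ... | true | true = true
    ... | _    | _    = false

  C : Fin n → Fin n → Set
  C v x = IsLeaf x × Ancestor v x

  Adj : Fin n → Fin n → Set
  Adj u v = Arc u v ⊎ Arc v u

  Simple : Set
  Simple = ∀ v → ¬ Arc v v

  Acyclic : Set
  Acyclic = ∀ u v → Arc u v → ¬ Ancestor v u

  Connected : Set
  Connected = ∀ u v → Star Adj u v

  data AdjWalk : List (Fin n) → Set where
    one  : ∀ v → AdjWalk (v ∷ [])
    cons : ∀ u v vs → Adj u v → AdjWalk (v ∷ vs) → AdjWalk (u ∷ v ∷ vs)

  data Last : List (Fin n) → Fin n → Set where
    last-one  : ∀ v → Last (v ∷ []) v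
    last-cons : ∀ u vs w → Last vs w → Last (u ∷ vs) w

  UCycle : List (Fin n) → Set
  UCycle [] = ⊥
  UCycle (v ∷ vs) =
    3 ≤ length (v ∷ vs) × Unique (v ∷ vs) × AdjWalk (v ∷ vs) ×
    Σ (Fin n) (λ w → Last (v ∷ vs) w × Adj w v)

  UnderlyingTree : Set
  UnderlyingTree = Connected × (∀ cs → ¬ UCycle cs)

  record IsNetwork : Set where
    field
      simple       : Simple
      acyclic      : Acyclic
      connected    : Connected
      twoLeaves    : 2 ≤ leafCount
      rootOutdeg   : ∀ v → indeg v ≡ 0 → 2 ≤ outdeg v
      sinkIsLeaf   : ∀ v → outdeg v ≡ 0 → indeg v ≡ 1
      noDeg11      : ∀ v → ¬ (indeg v ≡ 1 × outdeg v ≡ 1)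

  IsArboreal : Set
  IsArboreal = IsNetwork × UnderlyingTree

{-# OPTIONS --safe #-}
-- The underlying graph is a tree, so a walk that never steps straight back cannot
-- return to its start.  Two distinct arcs out of u towards a common descendant, or
-- two distinct last arcs of paths from a common ancestor, would close such a walk;
-- this gives (i).  For (ii), follow v and u down to a common leaf and let h be where
-- the two paths first meet.  Its two in-arcs make h a non-leaf, and the closed-walk
-- argument shows that any common descendant of u and v yields the same meeting
-- vertex h, so every leaf below v lies below h.
module Submission where

open import Defs
open import Data.Nat using (ℕ; zero; suc; _≤_; _<_; z≤n; s≤s; _≤′_; ≤′-step; ≤′-reflexive)
  renaming (_≟_ to _≟ℕ_)
open import Data.Nat.Properties using (≤-trans; ≤⇒≤′; n<1+n; n≤1+n)
open import Data.Fin using (Fin; zero; suc; toℕ; _≟_)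
open import Data.Fin.Properties using (pigeonhole; toℕ≤pred[n])
open import Data.Bool using (Bool; true; false; T)
open import Data.List using (List; []; _∷_; _++_)
open import Data.List.Relation.Unary.Any using (here; there)
open import Data.List.Relation.Unary.All using ([]; _∷_; lookup)
open import Data.List.Relation.Unary.All.Properties using (¬Any⇒All¬; ++⁻ˡ)
open import Data.List.Relation.Unary.AllPairs using ([]; _∷_)
open import Data.List.Relation.Unary.Unique.Propositional using (Unique)
open import Data.List.Membership.Propositional using (_∈_)
open import Data.List.Membership.Propositional.Properties using (∈-∃++; ∈-insert)
open import Data.Product using (_×_; Σ; _,_; proj₁; proj₂; swap)
open import Data.Sum using (_⊎_; inj₁; inj₂) renaming (swap to ⊎-swap)
open import Data.Empty using (⊥; ⊥-elim)
open import Function using (_∘_; id)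
open import Relation.Nullary using (¬_; yes; no)
open import Relation.Binary.PropositionalEquality using (_≡_; _≢_; refl; sym; trans; subst; cong; ≢-sym)
open import Relation.Binary.Construct.Closure.ReflexiveTransitive using (Star; ε; _◅_; _◅◅_; reverse)

1≤count : ∀ {n} (p : Fin n → Bool) {i} → T (p i) → 1 ≤ count p
1≤count p {zero} pi with p zero
... | true = s≤s z≤n
1≤count p {suc i} pi with p zero
... | true = s≤s z≤n
... | false = 1≤count (p ∘ suc) pi

2≤count : ∀ {n} (p : Fin n → Bool) {i j} → i ≢ j → T (p i) → T (p j) → 2 ≤ count p
2≤count p {zero} {zero} i≢j _ _ = ⊥-elim (i≢j refl)
2≤count p {zero} {suc j} _ pi pj with p zero
... | true = s≤s (1≤count (p ∘ suc) pj)
2≤count p {suc i} {zero} _ pi pj with p zero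
... | true = s≤s (1≤count (p ∘ suc) pi)
2≤count p {suc i} {suc j} i≢j pi pj with p zero
... | true = s≤s (1≤count (p ∘ suc) pi)
... | false = 2≤count (p ∘ suc) (i≢j ∘ cong suc) pi pj

count≢0⇒∃ : ∀ {n} (p : Fin n → Bool) → count p ≢ 0 → Σ (Fin n) (T ∘ p)
count≢0⇒∃ {zero} p c≢0 = ⊥-elim (c≢0 refl)
count≢0⇒∃ {suc n} p c≢0 with p zero in eq
... | true = zero , subst T (sym eq) _
... | false with count≢0⇒∃ (p ∘ suc) c≢0
...   | i , pi = suc i , pi

split-last : ∀ {A : Set} {R : A → A → Set} {a a₁ b} → R a a₁ → Star R a₁ b →
  Σ A λ q → Star R a q × R q b
split-last r ε = _ , ε , r
split-last r (r′ ◅ rs) with split-last r′ rs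
... | q , path , last = q , r ◅ path , last

prefix-or-diverge : ∀ {n} {R : Fin n → Fin n → Set} {a b c} → Star R a b → Star R a c →
  Star R b c ⊎ Star R c b ⊎
  Σ (Fin n) λ z → Σ (Fin n) λ s → Σ (Fin n) λ s′ →
    s ≢ s′ × Star R a z × R z s × Star R s b × R z s′ × Star R s′ c
prefix-or-diverge ε Q = inj₁ Q
prefix-or-diverge P ε = inj₂ (inj₁ P)
prefix-or-diverge (_◅_ {j = s} r P) (_◅_ {j = s′} r′ Q) with s ≟ s′
... | no s≢s′ = inj₂ (inj₂ (_ , s , s′ , s≢s′ , ε , r , P , r′ , Q))
... | yes refl with prefix-or-diverge P Q
...   | inj₁ b⇝c = inj₁ b⇝c
...   | inj₂ (inj₁ c⇝b) = inj₂ (inj₁ c⇝b)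
...   | inj₂ (inj₂ (z , t , t′ , t≢t′ , s⇝z , rest)) = inj₂ (inj₂ (z , t , t′ , t≢t′ , r ◅ s⇝z , rest))

Unique-++-∷ : ∀ {A : Set} (xs : List A) {y ys} → Unique (xs ++ y ∷ ys) → Unique (y ∷ xs)
Unique-++-∷ [] _ = [] ∷ []
Unique-++-∷ (x ∷ xs) (x∉ ∷ u) with Unique-++-∷ xs u
... | y∉xs ∷ uxs = (≢-sym (lookup x∉ (∈-insert xs)) ∷ y∉xs) ∷ ++⁻ˡ xs x∉ ∷ uxs

module _ {n : ℕ} (G : Digraph n) where

  private variable
    a b c c′ p q t t′ u v w x y z : Fin n

  walk-prefix : ∀ x ys z zs → AdjWalk G (x ∷ ys ++ z ∷ zs) →
    AdjWalk G (x ∷ ys) × Σ (Fin n) λ w → Last G (x ∷ ys) w × Adj G w z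
  walk-prefix x [] z zs (cons _ _ _ xz _) = one x , x , last-one x , xz
  walk-prefix x (y ∷ ys) z zs (cons _ _ _ xy rest) with walk-prefix y ys z zs rest
  ... | walk , w , last , wz = cons x y ys xy walk , w , last-cons x (y ∷ ys) w last , wz

  -- Walks are encoded by their darts (pairs of consecutive vertices).
  data Turn : Fin n × Fin n → Fin n × Fin n → Set where
    turn : Adj G u v → Adj G v w → u ≢ w → Turn (u , v) (v , w)

  ReducedWalk : Fin n × Fin n → Fin n × Fin n → Set
  ReducedWalk = Star Turn

  reverse-walk : ∀ {e e′} → ReducedWalk e e′ → ReducedWalk (swap e′) (swap e)
  reverse-walk ε = ε
  reverse-walk (turn uv vw u≢w ◅ W) = reverse-walk W ◅◅ turn (⊎-swap vw) (⊎-swap uv) (≢-sym u≢w) ◅ ε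

  trail : ∀ {e e′} → ReducedWalk e e′ → List (Fin n)
  trail ε = []
  trail (turn {w = w} _ _ _ ◅ W) = w ∷ trail W

  trail-walk : ∀ {e} → Adj G a b → (W : ReducedWalk (a , b) e) → AdjWalk G (a ∷ b ∷ trail W)
  trail-walk ab ε = cons _ _ _ ab (one _)
  trail-walk ab (turn _ bc _ ◅ W) = cons _ _ _ ab (trail-walk bc W)

  end∈trail : (W : ReducedWalk (a , b) (y , z)) → z ∈ b ∷ trail W
  end∈trail ε = here refl
  end∈trail (turn _ _ _ ◅ W) = there (end∈trail W)

  module _ (loopless : Simple G) (no-cycle : ∀ cs → ¬ UCycle G cs) where

    Adj⇒≢ : Adj G a b → a ≢ b
    Adj⇒≢ (inj₁ ab) refl = loopless _ ab
    Adj⇒≢ (inj₂ ba) refl = loopless _ ba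

    -- A first return to a would close an undirected cycle, a loop, or an immediate backtrack.
    trail-unique : ∀ {e} → Adj G a b → (W : ReducedWalk (a , b) e) → Unique (a ∷ b ∷ trail W)
    trail-unique ab ε = (Adj⇒≢ ab ∷ []) ∷ [] ∷ []
    trail-unique {a} ab W@(turn _ bc a≢c ◅ W′) with trail-unique bc W′
    ... | rest-unique = ¬Any⇒All¬ _ a∉ ∷ rest-unique
      where
      a∉ : a ∈ _ ∷ trail W → ⊥
      a∉ a∈ with ∈-∃++ a∈
      ... | [] , _ , refl = Adj⇒≢ ab refl
      ... | _ ∷ [] , _ , refl = a≢c refl
      ... | b ∷ c ∷ pre , post , eq with walk-prefix a (b ∷ c ∷ pre) a post
                                           (subst (AdjWalk G ∘ (a ∷_)) eq (trail-walk ab W))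
      ...   | cycle-walk , w , last , wa =
        no-cycle (a ∷ b ∷ c ∷ pre)
          (s≤s (s≤s (s≤s z≤n)) , Unique-++-∷ (b ∷ c ∷ pre) (subst Unique eq rest-unique) ,
           cycle-walk , w , last , wa)

    no-closed-walk : Adj G a b → ¬ ReducedWalk (a , b) (y , a)
    no-closed-walk ab W with trail-unique ab W
    ... | a∉ ∷ _ = lookup a∉ (end∈trail W) refl

  module _ (acyclic : Acyclic G) where

    arcs-turn : Arc G u v → Arc G v w → Turn (u , v) (v , w)
    arcs-turn uv vw = turn (inj₁ uv) (inj₁ vw) λ { refl → acyclic _ _ uv (vw ◅ ε) }

    path-walk : Arc G a b → Ancestor G b p → Arc G p c → ReducedWalk (a , b) (p , c)
    path-walk ab ε bc = arcs-turn ab bc ◅ ε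
    path-walk ab (bb′ ◅ P) pc = arcs-turn ab bb′ ◅ path-walk bb′ P pc

    path-walk-from : Arc G a b → Ancestor G b c → Σ (Fin n) λ p → Arc G p c × ReducedWalk (a , b) (p , c)
    path-walk-from ab ε = _ , ab , ε
    path-walk-from ab (bb′ ◅ P) with path-walk-from bb′ P
    ... | p , pc , W = p , pc , arcs-turn ab bb′ ◅ W

    path-walk-to : Ancestor G a p → Arc G p c → Σ (Fin n) λ b → Arc G a b × ReducedWalk (a , b) (p , c)
    path-walk-to ε pc = _ , pc , ε
    path-walk-to (ab ◅ P) pc = _ , ab , path-walk ab P pc

    comparable-or-reduced-walk : Ancestor G w p → Arc G p t → Ancestor G w q → Arc G q t′ →
      Ancestor G t t′ ⊎ Ancestor G t′ t ⊎ ReducedWalk (t , p) (q , t′)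
    comparable-or-reduced-walk {t = t} {t′ = t′} ε pt ε qt′ with t ≟ t′
    ... | yes refl = inj₁ ε
    ... | no t≢t′ = inj₂ (inj₂ (turn (inj₂ pt) (inj₁ qt′) t≢t′ ◅ ε))
    comparable-or-reduced-walk {t = t} ε pt (_◅_ {j = g} wg Q) qt′ with g ≟ t
    ... | yes refl = inj₁ (Q ◅◅ qt′ ◅ ε)
    ... | no g≢t = inj₂ (inj₂ (turn (inj₂ pt) (inj₁ wg) (≢-sym g≢t) ◅ path-walk wg Q qt′))
    comparable-or-reduced-walk {t′ = t′} (_◅_ {j = g} wg P) pt ε qt′ with g ≟ t′
    ... | yes refl = inj₂ (inj₁ (P ◅◅ pt ◅ ε))
    ... | no g≢t′ = inj₂ (inj₂ (reverse-walk (path-walk wg P pt) ◅◅ turn (inj₂ wg) (inj₁ qt′) g≢t′ ◅ ε))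
    comparable-or-reduced-walk (_◅_ {j = g} wg P) pt (_◅_ {j = g′} wg′ Q) qt′ with g ≟ g′
    ... | yes refl = comparable-or-reduced-walk P pt Q qt′
    ... | no g≢g′ = inj₂ (inj₂ (reverse-walk (path-walk wg P pt) ◅◅ turn (inj₂ wg) (inj₁ wg′) g≢g′ ◅ path-walk wg′ Q qt′))

    Chain : ℕ → (ℕ → Fin n) → Set
    Chain k f = ∀ m → m < k → Arc G (f m) (f (suc m))

    chain-ancestor : ∀ {k f i j} → Chain k f → i ≤′ j → j ≤ k → Ancestor G (f i) (f j)
    chain-ancestor chain (≤′-reflexive refl) _ = ε
    chain-ancestor {j = suc j} chain (≤′-step i≤′j) j<k =
      chain-ancestor chain i≤′j (≤-trans (n≤1+n j) j<k) ◅◅ chain j j<k ◅ ε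

    no-chain-of-length-n : ∀ f → ¬ Chain n f
    no-chain-of-length-n f chain with pigeonhole (n<1+n n) (f ∘ toℕ)
    ... | i , j , i<j , fi≡fj =
      acyclic _ _ (chain (toℕ i) (≤-trans i<j j≤n))
        (subst (Ancestor G _) (sym fi≡fj) (chain-ancestor chain (≤⇒≤′ i<j) j≤n))
      where
      j≤n : toℕ j ≤ n
      j≤n = toℕ≤pred[n] j

    sink-below-or-chain : ∀ k w → (Σ (Fin n) λ x → outdeg G x ≡ 0 × Ancestor G w x) ⊎
                                  (Σ (ℕ → Fin n) λ f → f 0 ≡ w × Chain k f)
    sink-below-or-chain zero w = inj₂ ((λ _ → w) , refl , λ _ ())
    sink-below-or-chain (suc k) w with outdeg G w ≟ℕ 0
    ... | yes sink = inj₁ (w , sink , ε)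
    ... | no ¬sink with count≢0⇒∃ (G w) ¬sink
    ...   | c , wc with sink-below-or-chain k c
    ...     | inj₁ (x , sink , c⇝x) = inj₁ (x , sink , wc ◅ c⇝x)
    ...     | inj₂ (f , refl , chain) = inj₂ (g , refl , g-chain)
      where
      g : ℕ → Fin n
      g zero = w
      g (suc m) = f m
      g-chain : Chain (suc k) g
      g-chain zero _ = wc
      g-chain (suc m) (s≤s m<k) = chain m m<k

    sink-below : ∀ w → Σ (Fin n) λ x → outdeg G x ≡ 0 × Ancestor G w x
    sink-below w with sink-below-or-chain n w
    ... | inj₁ sink = sink
    ... | inj₂ (f , _ , chain) = ⊥-elim (no-chain-of-length-n f chain)

  record Meet (v u t : Fin n) : Set where
    constructor meet
    field
      {left right} : Fin n
      left≢right : left ≢ right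
      v⇝left : Ancestor G v left
      left→t : Arc G left t
      u⇝right : Ancestor G u right
      right→t : Arc G right t

    v⇝t : Ancestor G v t
    v⇝t = v⇝left ◅◅ left→t ◅ ε

    u⇝t : Ancestor G u t
    u⇝t = u⇝right ◅◅ right→t ◅ ε

  open Meet

  meet-above : Ancestor G v x → Ancestor G u x → ¬ Ancestor G u v → ¬ Ancestor G v u →
    Σ (Fin n) λ t → Meet v u t × Ancestor G t x
  meet-above v⇝x u⇝x u⋬v v⋬u with prefix-or-diverge (reverse id v⇝x) (reverse id u⇝x)
  ... | inj₁ v⇜u = ⊥-elim (u⋬v (reverse id v⇜u))
  ... | inj₂ (inj₁ u⇜v) = ⊥-elim (v⋬u (reverse id u⇜v))
  ... | inj₂ (inj₂ (t , s , s′ , s≢s′ , x⇜t , ts , s⇜v , ts′ , s′⇜u)) =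
    t , meet s≢s′ (reverse id s⇜v) ts (reverse id s′⇜u) ts′ , reverse id x⇜t

  meet-not-leaf : Meet v u t → ¬ IsLeaf G t
  meet-not-leaf m (indeg≡1 , _) with subst (2 ≤_) indeg≡1 (2≤count (λ w → G w _) (left≢right m) (left→t m) (right→t m))
  ... | s≤s ()

  module _ (loopless : Simple G) (acyclic : Acyclic G) (no-cycle : ∀ cs → ¬ UCycle G cs) where

    unique-first-arc : Arc G u c → Ancestor G c x → Arc G u c′ → Ancestor G c′ x → c ≡ c′
    unique-first-arc {c = c} {c′ = c′} uc c⇝x uc′ c′⇝x with c ≟ c′
    ... | yes c≡c′ = c≡c′
    ... | no c≢c′ with path-walk-from acyclic uc c⇝x | path-walk-from acyclic uc′ c′⇝x
    ...   | _ , px , W | _ , _ , W′ =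
      ⊥-elim (no-closed-walk loopless no-cycle (inj₂ px)
        (reverse-walk W ◅◅ turn (inj₂ uc) (inj₁ uc′) c≢c′ ◅ W′))

    unique-last-arc : Ancestor G a p → Arc G p b → Ancestor G a q → Arc G q b → p ≡ q
    unique-last-arc {p = p} {q = q} a⇝p pb a⇝q qb with p ≟ q
    ... | yes p≡q = p≡q
    ... | no p≢q with path-walk-to acyclic a⇝p pb | path-walk-to acyclic a⇝q qb
    ...   | _ , af , W | _ , _ , W′ =
      ⊥-elim (no-closed-walk loopless no-cycle (inj₁ af)
        (W ◅◅ turn (inj₁ pb) (inj₂ qb) p≢q ◅ reverse-walk W′))

    meet-ordered : Meet v u t → Meet v u t′ → Ancestor G t t′ → t ≡ t′
    meet-ordered m m′ ε = refl
    meet-ordered m m′ (tt₁ ◅ R) with split-last tt₁ R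
    ... | q , t⇝q , qt′ = ⊥-elim (left≢right m′ (trans (sym q≡left′) q≡right′))
      where
      q≡left′ : q ≡ left m′
      q≡left′ = unique-last-arc (v⇝t m ◅◅ t⇝q) qt′ (v⇝left m′) (left→t m′)
      q≡right′ : q ≡ right m′
      q≡right′ = unique-last-arc (u⇝t m ◅◅ t⇝q) qt′ (u⇝right m′) (right→t m′)

    meet-unique : Meet v u t → Meet v u t′ → t ≡ t′
    meet-unique m m′ with comparable-or-reduced-walk acyclic (u⇝right m) (right→t m) (u⇝right m′) (right→t m′)
    ... | inj₁ t⇝t′ = meet-ordered m m′ t⇝t′
    ... | inj₂ (inj₁ t′⇝t) = sym (meet-ordered m′ m t′⇝t)
    ... | inj₂ (inj₂ W) with path-walk-to acyclic (v⇝left m) (left→t m) | path-walk-to acyclic (v⇝left m′) (left→t m′)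
    ...   | _ , vf , V | _ , _ , V′ =
      ⊥-elim (no-closed-walk loopless no-cycle (inj₁ vf)
        (V ◅◅ turn (inj₁ (left→t m)) (inj₂ (right→t m)) (left≢right m) ◅
         W ◅◅ turn (inj₁ (right→t m′)) (inj₂ (left→t m′)) (≢-sym (left≢right m′)) ◅ reverse-walk V′))

    child-towards : u ≢ v → Ancestor G u v →
      Σ (Fin n) λ c → (Arc G u c × Ancestor G c v) ×
        (∀ c′ → Arc G u c′ → Ancestor G c′ v → c′ ≡ c) ×
        (∀ u′ → Arc G u u′ → u′ ≢ c → ∀ x → C G u′ x → C G v x → ⊥)
    child-towards u≢v ε = ⊥-elim (u≢v refl)
    child-towards _ (uc ◅ c⇝v) =
      _ , (uc , c⇝v) ,
      (λ c′ uc′ c′⇝v → unique-first-arc uc′ c′⇝v uc c⇝v) ,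
      λ u′ uu′ u′≢c x (_ , u′⇝x) (_ , v⇝x) → u′≢c (unique-first-arc uu′ u′⇝x uc (c⇝v ◅◅ v⇝x))

module _ {n : ℕ} {G : Digraph n} (arboreal : IsArboreal G) where
  open IsNetwork (proj₁ arboreal)
  open Meet

  leaf-below : ∀ w → Σ (Fin n) λ x → IsLeaf G x × Ancestor G w x
  leaf-below w with sink-below G acyclic w
  ... | x , sink , w⇝x = x , (sinkIsLeaf x sink , sink) , w⇝x

  incomparable-cover : ∀ {u v} → (∀ x → C G v x → C G u x) → Incomparable G u v →
    Σ (Fin n) λ h → ¬ IsLeaf G h × Ancestor G u h × Ancestor G v h ×
      (∀ x → C G h x → C G v x) × (∀ x → C G v x → C G h x)
  incomparable-cover {v = v} C[v]⊆C[u] (u⋬v , v⋬u) with leaf-below v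
  ... | x , x-leaf , v⇝x with meet-above G v⇝x (proj₂ (C[v]⊆C[u] x (x-leaf , v⇝x))) u⋬v v⋬u
  ...   | t , m , _ =
    t , meet-not-leaf G m , u⇝t m , v⇝t m , (λ y (y-leaf , t⇝y) → y-leaf , v⇝t m ◅◅ t⇝y) , C[v]⊆C[t]
    where
    C[v]⊆C[t] : ∀ y → C G v y → C G t y
    C[v]⊆C[t] y (y-leaf , v⇝y) with meet-above G v⇝y (proj₂ (C[v]⊆C[u] y (y-leaf , v⇝y))) u⋬v v⋬u
    ... | t′ , m′ , t′⇝y =
      y-leaf , subst (λ z → Ancestor G z y) (sym (meet-unique G simple acyclic (proj₂ (proj₂ arboreal)) m m′)) t′⇝y

lemma9p2 : {n : ℕ} (G : Digraph n) → IsArboreal G → (u v : Fin n) → u ≢ v →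
    (Ancestor G u v →
      Σ (Fin n) (λ c → (Arc G u c × Ancestor G c v) ×
        (∀ c' → Arc G u c' → Ancestor G c' v → c' ≡ c) ×
        (∀ u' → Arc G u u' → u' ≢ c → ∀ x → C G u' x → C G v x → ⊥)))
    ×
    ((∀ x → C G v x → C G u x) → Incomparable G u v →
      Σ (Fin n) (λ h → ¬ IsLeaf G h × Ancestor G u h × Ancestor G v h ×
        (∀ x → C G h x → C G v x) × (∀ x → C G v x → C G h x)))
lemma9p2 G arboreal@(network , _ , no-cycle) u v u≢v =
  child-towards G simple acyclic no-cycle u≢v , incomparable-cover arboreal
  where open IsNetwork network
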